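{- Let $k>1$ be an integer. If a positive integer $n$ is $2k$-layered, then $n$ is a Zumkeller number.
   Context: For a positive integer $k$, a positive integer $n$ is $k$-layered if the set of its positive divisors can be partitioned into $k$ disjoint subsets all having the same sum. A Zumkeller number is a $2$-layered number, i.e. one whose divisors can be partitioned into two disjoint subsets with equal sums. -}

module Defs where

open import Data.Nat using (ℕ; suc; _>_)
open import Data.Nat.Divisibility using (_∣?_)
open import Data.Fin using (Fin; _≟_)
open import Data.List using (List; filter; upTo)
open import Data.Nat.ListAction using (sum)
open import Data.Product using (∃)
open import Relation.Binary.PropositionalEquality using (_≡_)

-- the list of positive divisors of n (for n > 0): all d in 1..n with d ∣ n
-- (0 is filtered out for n > 0 since 0 ∤ n; 0 contributes nothing to sums anyway)
divisors : ℕ → List ℕ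
divisors n = filter (_∣? n) (upTo (suc n))

blockSum : {k : ℕ} → ℕ → (ℕ → Fin k) → Fin k → ℕ
blockSum n c j = sum (filter (λ d → c d ≟ j) (divisors n))

-- n is k-layered: the divisors of n can be partitioned into k disjoint
-- subsets (blocks indexed by Fin k, given by the assignment c) with equal sums
Layered : ℕ → ℕ → Set
Layered k n = ∃ λ (c : ℕ → Fin k) → ∃ λ (s : ℕ) → (j : Fin k) → blockSum n c j ≡ s

Zumkeller : ℕ → Set
Zumkeller n = Layered 2 n

module Submission where

-- A 2k-layered number is Zumkeller: merge the 2k blocks into two groups of
-- k blocks each; both groups then have the same sum, namely k times the
-- common block sum.
--
-- This holds at its natural generality: an (m·k)-layered number is
-- m-layered (for all m and k).  The coarser colouring sends a divisor of
-- colour i : Fin (m * k) to the colour 'quotient k i' : Fin m, so the new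
-- block j is the union of the k old blocks 'combine j r' (r : Fin k).  The main theorem is the case m = 2.

open import Defs
open import Data.Nat using (ℕ; zero; suc; _+_; _*_; _>_)
open import Data.Nat.Properties using (+-identityʳ; +-*-semiring)
open import Data.Nat.ListAction using (sum)
open import Data.Bool using (true; false; if_then_else_)
open import Data.Fin using (Fin; _≟_; quotient; remainder; combine)
  renaming (zero to fzero; suc to fsuc)
open import Data.Fin.Properties using (remQuot-combine; combine-remQuot; combine-injectiveʳ)
open import Data.List using (List; []; _∷_; filter)
open import Data.Product using (_,_; proj₁)
open import Function using (_∘_)
open import Level using (Level)
open import Relation.Nullary using (Dec; does; yes; no)
open import Relation.Nullary.Decidable using (dec-true; dec-false)
open import Relation.Unary using (Pred; Decidable)
open import Relation.Binary.PropositionalEquality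
open import Algebra.Properties.Semiring.Sum +-*-semiring
  using (∑-distrib-+; sum-cong-≗; sum-replicate-zero; sum-syntax)
open ≡-Reasoning

keepIf : {a : Level} {A : Set a} → Dec A → ℕ → ℕ
keepIf a? x = if does a? then x else 0

colourSum : {k : ℕ} → (ℕ → Fin k) → List ℕ → Fin k → ℕ
colourSum c L i = sum (filter (λ d → c d ≟ i) L)

sum-filter-∷ : {p : Level} {P : Pred ℕ p} (P? : Decidable P) (x : ℕ) (L : List ℕ) →
               sum (filter P? (x ∷ L)) ≡ keepIf (P? x) x + sum (filter P? L)
sum-filter-∷ P? x L with does (P? x)
... | true  = refl
... | false = refl

∑-delta : {k : ℕ} (r₀ : Fin k) (x : ℕ) → ∑[ r < k ] keepIf (r₀ ≟ r) x ≡ x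
∑-delta {suc k} fzero     x = trans (cong (x +_) (sum-replicate-zero k)) (+-identityʳ x)
∑-delta         (fsuc r₀) x = ∑-delta r₀ x

-- The k colours combine j r (r : Fin k) are exactly those with quotient j:
-- summing the indicator of 'i = combine j r' over r gives that of 'quotient k i = j'.
∑-delta-combine : {m k : ℕ} (i : Fin (m * k)) (j : Fin m) (x : ℕ) →
                  ∑[ r < k ] keepIf (i ≟ combine j r) x ≡ keepIf (quotient k i ≟ j) x
∑-delta-combine {m} {k} i j x with quotient k i ≟ j
... | yes refl = begin
  ∑[ r < k ] keepIf (i ≟ combine j r) x
    ≡⟨ sum-cong-≗ (λ r → cong (λ b → if b then x else 0) (same-test r)) ⟩
  ∑[ r < k ] keepIf (remainder {m} k i ≟ r) x
    ≡⟨ ∑-delta (remainder {m} k i) x ⟩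
  x ∎
  where
    -- i is combine j (remainder i), and combine j is injective
    i≡combine : combine j (remainder {m} k i) ≡ i
    i≡combine = combine-remQuot {m} k i
    same-test : ∀ r → does (i ≟ combine j r) ≡ does (remainder {m} k i ≟ r)
    same-test r with remainder {m} k i ≟ r
    ... | yes refl = dec-true (i ≟ combine j _) (sym i≡combine)
    ... | no  r₀≢r = dec-false (i ≟ combine j r)
      (λ i≡jr → r₀≢r (combine-injectiveʳ j _ j r (trans i≡combine i≡jr)))
... | no q≢j = trans (sum-cong-≗ (λ r → cong (λ b → if b then x else 0) (not-hit r)))
                     (sum-replicate-zero k)
  where
    -- a colour combine j r has quotient j, which i does not
    not-hit : ∀ r → does (i ≟ combine j r) ≡ false
    not-hit r = dec-false (i ≟ combine j r)
      (λ i≡jr → q≢j (trans (cong (quotient k) i≡jr) (cong proj₁ (remQuot-combine j r))))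

merged-colourSum : {m k : ℕ} (c : ℕ → Fin (m * k)) (L : List ℕ) (j : Fin m) →
                   colourSum (quotient k ∘ c) L j ≡ ∑[ r < k ] colourSum c L (combine j r)
merged-colourSum {k = k} c [] j = sym (sum-replicate-zero k)
merged-colourSum {k = k} c (x ∷ L) j = begin
  colourSum (quotient k ∘ c) (x ∷ L) j
    ≡⟨ sum-filter-∷ (λ d → quotient k (c d) ≟ j) x L ⟩
  keepIf (quotient k (c x) ≟ j) x + colourSum (quotient k ∘ c) L j
    ≡⟨ cong₂ _+_ (sym (∑-delta-combine (c x) j x)) (merged-colourSum c L j) ⟩
  ∑[ r < k ] keepIf (c x ≟ combine j r) x + ∑[ r < k ] colourSum c L (combine j r)
    ≡⟨ sym (∑-distrib-+ (λ r → keepIf (c x ≟ combine j r) x) (colourSum c L ∘ combine j)) ⟩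
  ∑[ r < k ] (keepIf (c x ≟ combine j r) x + colourSum c L (combine j r))
    ≡⟨ sum-cong-≗ (λ r → sym (sum-filter-∷ (λ d → c d ≟ combine j r) x L)) ⟩
  ∑[ r < k ] colourSum c (x ∷ L) (combine j r) ∎

∑-const : (k s : ℕ) → ∑[ r < k ] s ≡ k * s
∑-const zero    s = refl
∑-const (suc k) s = cong (s +_) (∑-const k s)

coarsen : (m k n : ℕ) → Layered (m * k) n → Layered m n
coarsen m k n (c , s , equal) = quotient k ∘ c , k * s , λ j → begin
  blockSum n (quotient k ∘ c) j           ≡⟨ merged-colourSum c (divisors n) j ⟩
  ∑[ r < k ] blockSum n c (combine j r)   ≡⟨ sum-cong-≗ (λ r → equal (combine j r)) ⟩
  ∑[ r < k ] s                            ≡⟨ ∑-const k s ⟩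
  k * s                                   ∎

-- Main theorem: the case m = 2.
mainTheorem10 : (k n : ℕ) → k > 1 → n > 0 → Layered (2 * k) n → Zumkeller n
mainTheorem10 k n _ _ = coarsen 2 k n
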